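{- Let $R$ be a finite associative ring with unity. Suppose $(a,b)\in {}^2\!R$ is not unimodular and $R(a,b)$ is a free cyclic submodule of ${}^2\!R$. Then $R$ has at least two maximal right ideals, and at least one of the maximal right ideals of $R$ is not principal.
   Context: ${}^2\!R$ denotes the left $R$-module $R\times R$ with $\alpha(a,b)=(\alpha a,\alpha b)$. For $(a,b)\in{}^2\!R$, $R(a,b)=\{(\alpha a,\alpha b):\alpha\in R\}$; it is called a free cyclic submodule if $(\alpha a,\alpha b)=(0,0)$ implies $\alpha=0$. A vector $(a,b)$ is unimodular if $aR+bR=R$, where $aR+bR=\{ax+by:x,y\in R\}$. A right ideal is principal if it equals $cR$ for some $c\in R$. -}

module Defs where

open import Level using (Level; _⊔_; suc)
open import Algebra.Bundles using (Ring)
open import Data.Nat using (ℕ)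
open import Data.Fin using (Fin)
open import Data.Product using (Σ; _×_; ∃; ∃-syntax)
open import Relation.Nullary using (¬_)
open import Relation.Binary.PropositionalEquality using (_≡_)

module RingNotions {c ℓ : Level} (R : Ring c ℓ) where
  open Ring R

  Finite : Set (c ⊔ ℓ)
  Finite = Σ ℕ λ n → Σ (Fin n → Carrier) λ enum →
             (∀ x → Σ (Fin n) λ i → enum i ≈ x)
           × (∀ i j → enum i ≈ enum j → i ≡ j)

  Subset : Set (suc (c ⊔ ℓ))
  Subset = Carrier → Set (c ⊔ ℓ)

  _⊆_ : Subset → Subset → Set (c ⊔ ℓ)
  I ⊆ J = ∀ x → I x → J x

  _≐_ : Subset → Subset → Set (c ⊔ ℓ)
  I ≐ J = (I ⊆ J) × (J ⊆ I)

  record IsRightIdeal (I : Subset) : Set (c ⊔ ℓ) where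
    field
      resp  : ∀ {x y} → x ≈ y → I x → I y
      zero∈ : I 0#
      +-cl  : ∀ {x y} → I x → I y → I (x + y)
      neg-cl : ∀ {x} → I x → I (- x)
      *ʳ-cl : ∀ {x} (r : Carrier) → I x → I (x * r)

  Proper : Subset → Set (c ⊔ ℓ)
  Proper I = ¬ I 1#

  IsMaximalRightIdeal : Subset → Set (suc (c ⊔ ℓ))
  IsMaximalRightIdeal I =
    IsRightIdeal I × Proper I ×
    (∀ (J : Subset) → IsRightIdeal J → Proper J → I ⊆ J → J ⊆ I)

  principal : Carrier → Subset
  principal c x = ∃[ y ] (x ≈ c * y)

  IsPrincipal : Subset → Set (c ⊔ ℓ)
  IsPrincipal I = ∃[ c ] (I ≐ principal c)

  Unimodular : Carrier → Carrier → Set (c ⊔ ℓ)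
  Unimodular a b = ∃[ x ] ∃[ y ] (a * x + b * y ≈ 1#)

  FreeCyclic : Carrier → Carrier → Set (c ⊔ ℓ)
  FreeCyclic a b = ∀ α → α * a ≈ 0# → α * b ≈ 0# → α ≈ 0#

module Submission where

-- A finite ring has decidable equality, so every predicate
--   built from ≈ by finite quantification is decidable; decidable subsets can
--   be counted (as subsets of Fin n), a strict inclusion strictly increases
--   the count, and injective self-maps are surjective.
-- * Maximal ideals.  Every proper decidable right ideal I lies in a maximal
--   one: enlarge I to I + xR while this stays proper; the number of
--   non-members strictly decreases, so the process stops at a maximal ideal.
-- * The theorem.  Since (a,b) is not unimodular, aR + bR is proper, hence
--   contained in a maximal right ideal M.  M is not principal: if a,b ∈ gR,
--   freeness makes x ↦ xg injective, hence surjective, which forces g to be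
--   a unit.  M is not the only maximal right ideal: otherwise every u ∉ M
--   would be right invertible, and then αmR ⊊ αR for all α ≠ 0 and m ∈ M;
--   induction on |αR| together with freeness gives α = 0 for every α,
--   i.e. 1 = 0.  A non-invertible u ∉ M yields a second maximal ideal ⊇ uR.

open import Defs
open import Level using (Level; _⊔_)
open import Algebra.Bundles using (Ring)
open import Data.Product using (Σ; _×_; _,_; proj₁; proj₂; ∃; ∃-syntax)
open import Data.Nat using (ℕ; zero; suc; _<_)
import Data.Nat.Properties as ℕ
open import Data.Nat.Induction using (<-wellFounded)
open import Induction.WellFounded using (Acc; acc)
open import Data.Fin using (Fin; punchOut)
open import Data.Fin.Properties using (any?; punchOut-injective; injective⇒≤)
  renaming (_≟_ to _≟ᶠ_)
open import Data.Fin.Subset using (_∈_; _⊂_; ∣_∣) renaming (Subset to FinSubset)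
open import Data.Fin.Subset.Properties using (p⊂q⇒∣p∣<∣q∣)
open import Data.Vec using (tabulate)
open import Data.Vec.Properties using (lookup∘tabulate; lookup⇒[]=; []=⇒lookup)
open import Data.Empty using (⊥; ⊥-elim)
open import Relation.Nullary using (¬_; Dec; yes; no; does)
open import Relation.Nullary.Decidable using (dec-true; ¬?; _×-dec_)
open import Relation.Unary using (Pred; Decidable)
open import Relation.Binary.Definitions using (_Respects_)
open import Relation.Binary.PropositionalEquality as ≡ using (_≡_)
import Algebra.Properties.Ring as RingProperties
import Algebra.Properties.AbelianGroup as AbelianGroupProperties
import Algebra.Properties.CommutativeSemigroup as CommutativeSemigroupProperties

⟦_⟧ : ∀ {n p} {P : Pred (Fin n) p} → Decidable P → FinSubset n
⟦ P? ⟧ = tabulate (λ i → does (P? i))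

∈⟦⟧⁺ : ∀ {n p} {P : Pred (Fin n) p} (P? : Decidable P) {i : Fin n} →
  P i → i ∈ ⟦ P? ⟧
∈⟦⟧⁺ P? {i} Pi = lookup⇒[]= i _ (≡.trans (lookup∘tabulate _ i) (dec-true (P? i) Pi))

∈⟦⟧⁻ : ∀ {n p} {P : Pred (Fin n) p} (P? : Decidable P) {i : Fin n} →
  i ∈ ⟦ P? ⟧ → P i
∈⟦⟧⁻ P? {i} i∈P with P? i | ≡.trans (≡.sym (lookup∘tabulate _ i)) ([]=⇒lookup i∈P)
... | yes Pi | _ = Pi
... | no _   | ()

⟦⟧-< : ∀ {n p q} {P : Pred (Fin n) p} {Q : Pred (Fin n) q}
  (P? : Decidable P) (Q? : Decidable Q) → (∀ i → P i → Q i) →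
  (i : Fin n) → Q i → ¬ P i → ∣ ⟦ P? ⟧ ∣ < ∣ ⟦ Q? ⟧ ∣
⟦⟧-< P? Q? P⊆Q i Qi ¬Pi = p⊂q⇒∣p∣<∣q∣
  ( (λ {j} j∈P → ∈⟦⟧⁺ Q? (P⊆Q j (∈⟦⟧⁻ P? j∈P)))
  , i , ∈⟦⟧⁺ Q? Qi , (λ i∈P → ¬Pi (∈⟦⟧⁻ P? i∈P)) )

-- An injective self-map of Fin m is surjective: a map missing t would
-- inject Fin m into Fin (m - 1) by punching out t.
Fin-injective⇒surjective : ∀ {m} (f : Fin m → Fin m) →
  (∀ {i j} → f i ≡ f j → i ≡ j) → ∀ t → ∃ λ i → f i ≡ t
Fin-injective⇒surjective {zero} f f-injective ()
Fin-injective⇒surjective {suc m} f f-injective t with any? (λ i → f i ≟ᶠ t)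
... | yes hit = hit
... | no miss = ⊥-elim (ℕ.1+n≰n (injective⇒≤ g-injective))
  where
  t≢f : ∀ i → t ≡ f i → ⊥
  t≢f i t≡fi = miss (i , ≡.sym t≡fi)
  g : Fin (suc m) → Fin m
  g i = punchOut (t≢f i)
  g-injective : ∀ {i j} → g i ≡ g j → i ≡ j
  g-injective {i} {j} gi≡gj = f-injective (punchOut-injective (t≢f i) (t≢f j) gi≡gj)

module FiniteRing {c ℓ : Level} (R : Ring c ℓ) (finite : RingNotions.Finite R) where
  open Ring R
  open RingNotions R
  open RingProperties R using (-‿distribʳ-*; [y-z]x≈yx-zx; x[y-z]≈xy-xz)
  open AbelianGroupProperties +-abelianGroup using (⁻¹-∙-comm; x∙y⁻¹≈ε⇒x≈y)
  open CommutativeSemigroupProperties +-commutativeSemigroup using (interchange)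
  open import Relation.Binary.Reasoning.Setoid setoid

  size : ℕ
  size = proj₁ finite

  enum : Fin size → Carrier
  enum = proj₁ (proj₂ finite)

  index : Carrier → Fin size
  index x = proj₁ (proj₁ (proj₂ (proj₂ finite)) x)

  enum-index : ∀ x → enum (index x) ≈ x
  enum-index x = proj₂ (proj₁ (proj₂ (proj₂ finite)) x)

  enum-injective : ∀ {i j} → enum i ≈ enum j → i ≡ j
  enum-injective = proj₂ (proj₂ (proj₂ finite)) _ _

  index-cong : ∀ {x y} → x ≈ y → index x ≡ index y
  index-cong {x} {y} x≈y = enum-injective (trans (enum-index x) (trans x≈y (sym (enum-index y))))

  _≈?_ : ∀ x y → Dec (x ≈ y)
  x ≈? y with index x ≟ᶠ index y
  ... | yes same = yes (trans (sym (enum-index x)) (trans (reflexive (≡.cong enum same)) (enum-index y)))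
  ... | no differ = no (λ x≈y → differ (index-cong x≈y))

  search : ∀ {p} (P : Carrier → Set p) → P Respects _≈_ → Decidable P → Dec (∃ P)
  search P P-resp P? with any? (λ i → P? (enum i))
  ... | yes (i , Pi) = yes (enum i , Pi)
  ... | no none = no (λ (x , Px) → none (index x , P-resp (sym (enum-index x)) Px))

  ¬-resp : ∀ {p} {P : Carrier → Set p} → P Respects _≈_ → (λ x → ¬ P x) Respects _≈_
  ¬-resp P-resp x≈y ¬Px Py = ¬Px (P-resp (sym x≈y) Py)

  # : ∀ {p} {P : Carrier → Set p} → Decidable P → ℕ
  # P? = ∣ ⟦ (λ i → P? (enum i)) ⟧ ∣

  #-< : ∀ {p q} {P : Carrier → Set p} {Q : Carrier → Set q}
    (P? : Decidable P) (Q? : Decidable Q) → P Respects _≈_ → Q Respects _≈_ →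
    (∀ x → P x → Q x) → ∀ {x} → Q x → ¬ P x → # P? < # Q?
  #-< P? Q? P-resp Q-resp P⊆Q {x} Qx ¬Px =
    ⟦⟧-< (λ i → P? (enum i)) (λ i → Q? (enum i)) (λ i → P⊆Q (enum i)) (index x)
      (Q-resp (sym (enum-index x)) Qx) (¬-resp P-resp (sym (enum-index x)) ¬Px)

  injective⇒surjective : (f : Carrier → Carrier) → (∀ {x y} → f x ≈ f y → x ≈ y) →
    ∀ t → ∃ λ x → f x ≈ t
  injective⇒surjective f f-injective t =
    enum i , trans (sym (enum-index _)) (trans (reflexive (≡.cong enum fi≡t)) (enum-index t))
    where
    f̂ : Fin size → Fin size
    f̂ i = index (f (enum i))
    f̂-injective : ∀ {i j} → f̂ i ≡ f̂ j → i ≡ j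
    f̂-injective {i} {j} f̂i≡f̂j = enum-injective (f-injective
      (trans (sym (enum-index _)) (trans (reflexive (≡.cong enum f̂i≡f̂j)) (enum-index _))))
    i : Fin size
    i = proj₁ (Fin-injective⇒surjective f̂ f̂-injective (index t))
    fi≡t : f̂ i ≡ index t
    fi≡t = proj₂ (Fin-injective⇒surjective f̂ f̂-injective (index t))

  principal-isRightIdeal : ∀ x → IsRightIdeal (principal x)
  principal-isRightIdeal x = record
    { resp   = λ z≈z′ (y , z≈xy) → y , trans (sym z≈z′) z≈xy
    ; zero∈  = 0# , sym (zeroʳ x)
    ; +-cl   = λ (y₁ , z₁≈) (y₂ , z₂≈) → y₁ + y₂ , trans (+-cong z₁≈ z₂≈) (sym (distribˡ x y₁ y₂))
    ; neg-cl = λ (y , z≈) → - y , trans (-‿cong z≈) (-‿distribʳ-* x y)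
    ; *ʳ-cl  = λ r (y , z≈) → y * r , trans (*-congʳ z≈) (*-assoc x y r)
    }

  principal? : ∀ x → Decidable (principal x)
  principal? x z = search _ (λ y≈y′ z≈xy → trans z≈xy (*-congˡ y≈y′)) (λ y → z ≈? (x * y))

  _⊕_ : Subset → Carrier → Subset
  (I ⊕ x) z = ∃[ i ] ∃[ y ] (I i × z ≈ i + x * y)

  module _ {I : Subset} (I-ideal : IsRightIdeal I) where
    private module I = IsRightIdeal I-ideal

    ⊕-isRightIdeal : ∀ x → IsRightIdeal (I ⊕ x)
    ⊕-isRightIdeal x = record
      { resp   = λ z≈z′ (i , y , i∈I , z≈) → i , y , i∈I , trans (sym z≈z′) z≈
      ; zero∈  = 0# , 0# , I.zero∈ , sym (trans (+-identityˡ _) (zeroʳ x))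
      ; +-cl   = λ (i₁ , y₁ , i₁∈I , z₁≈) (i₂ , y₂ , i₂∈I , z₂≈) →
                   i₁ + i₂ , y₁ + y₂ , I.+-cl i₁∈I i₂∈I , sum-form z₁≈ z₂≈
      ; neg-cl = λ (i , y , i∈I , z≈) → - i , - y , I.neg-cl i∈I , neg-form z≈
      ; *ʳ-cl  = λ r (i , y , i∈I , z≈) → i * r , y * r , I.*ʳ-cl r i∈I , mul-form r z≈
      }
      where
      sum-form : ∀ {z₁ z₂ i₁ i₂ y₁ y₂} → z₁ ≈ i₁ + x * y₁ → z₂ ≈ i₂ + x * y₂ →
        z₁ + z₂ ≈ (i₁ + i₂) + x * (y₁ + y₂)
      sum-form {z₁} {z₂} {i₁} {i₂} {y₁} {y₂} z₁≈ z₂≈ = begin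
        z₁ + z₂                           ≈⟨ +-cong z₁≈ z₂≈ ⟩
        (i₁ + x * y₁) + (i₂ + x * y₂)     ≈⟨ interchange i₁ (x * y₁) i₂ (x * y₂) ⟩
        (i₁ + i₂) + (x * y₁ + x * y₂)     ≈⟨ +-congˡ (distribˡ x y₁ y₂) ⟨
        (i₁ + i₂) + x * (y₁ + y₂)         ∎
      neg-form : ∀ {z i y} → z ≈ i + x * y → - z ≈ - i + x * - y
      neg-form {z} {i} {y} z≈ = begin
        - z                  ≈⟨ -‿cong z≈ ⟩
        - (i + x * y)        ≈⟨ ⁻¹-∙-comm i (x * y) ⟨
        - i + - (x * y)      ≈⟨ +-congˡ (-‿distribʳ-* x y) ⟩
        - i + x * - y        ∎
      mul-form : ∀ r {z i y} → z ≈ i + x * y → z * r ≈ i * r + x * (y * r)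
      mul-form r {z} {i} {y} z≈ = begin
        z * r                  ≈⟨ *-congʳ z≈ ⟩
        (i + x * y) * r        ≈⟨ distribʳ r i (x * y) ⟩
        i * r + (x * y) * r    ≈⟨ +-congˡ (*-assoc x y r) ⟩
        i * r + x * (y * r)    ∎

    ⊕-decidable : Decidable I → ∀ x → Decidable (I ⊕ x)
    ⊕-decidable I? x z = search _
      (λ i≈i′ (y , i∈I , z≈) → y , I.resp i≈i′ i∈I , trans z≈ (+-congʳ i≈i′))
      (λ i → search _
        (λ y≈y′ (i∈I , z≈) → i∈I , trans z≈ (+-congˡ (*-congˡ y≈y′)))
        (λ y → I? i ×-dec (z ≈? (i + x * y))))

    ⊆-⊕ : ∀ x → I ⊆ (I ⊕ x)
    ⊆-⊕ x z z∈I = z , 0# , z∈I , sym (trans (+-congˡ (zeroʳ x)) (+-identityʳ z))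

    x∈⊕ : ∀ x → (I ⊕ x) x
    x∈⊕ x = 0# , 1# , I.zero∈ , sym (trans (+-identityˡ _) (*-identityʳ x))

    ⊕-least : ∀ {J x} → IsRightIdeal J → I ⊆ J → J x → (I ⊕ x) ⊆ J
    ⊕-least J-ideal I⊆J x∈J z (i , y , i∈I , z≈) =
      J.resp (sym z≈) (J.+-cl (I⊆J i i∈I) (J.*ʳ-cl y x∈J))
      where module J = IsRightIdeal J-ideal

  ⊕-cong : ∀ {I x x′} → x ≈ x′ → (I ⊕ x) ⊆ (I ⊕ x′)
  ⊕-cong x≈x′ z (i , y , i∈I , z≈) = i , y , i∈I , trans z≈ (+-congˡ (*-congʳ x≈x′))

  -- Proper right ideals with decidable membership: the ideals on which the
  -- enlargement procedure below can decide what to do next.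
  record ProperIdeal : Set (Level.suc (c ⊔ ℓ)) where
    field
      member       : Subset
      member?      : Decidable member
      isRightIdeal : IsRightIdeal member
      proper       : Proper member
    open IsRightIdeal isRightIdeal public

  open ProperIdeal public using (member)

  principalᴾ : ∀ x → ¬ principal x 1# → ProperIdeal
  principalᴾ x xR-proper = record
    { member = principal x ; member? = principal? x
    ; isRightIdeal = principal-isRightIdeal x ; proper = xR-proper }

  _⊕ᴾ_[_] : (I : ProperIdeal) → ∀ x → Proper (member I ⊕ x) → ProperIdeal
  I ⊕ᴾ x [ I⊕x-proper ] = record
    { member = member I ⊕ x ; member? = ⊕-decidable I.isRightIdeal I.member? x
    ; isRightIdeal = ⊕-isRightIdeal I.isRightIdeal x ; proper = I⊕x-proper }
    where module I = ProperIdeal I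

  -- The number of non-members: the measure for enlarging ideals.
  ∉? : (I : ProperIdeal) → Decidable (λ x → ¬ member I x)
  ∉? I x = ¬? (ProperIdeal.member? I x)

  #outside : ProperIdeal → ℕ
  #outside I = # (∉? I)

  -- x ∉ I lies in I + xR, so I + xR has strictly fewer non-members.
  #outside-⊕ : (I : ProperIdeal) → ∀ {x} → ¬ member I x → (I⊕x-proper : Proper (member I ⊕ x)) →
    #outside (I ⊕ᴾ x [ I⊕x-proper ]) < #outside I
  #outside-⊕ I {x} x∉I I⊕x-proper = #-< (∉? (I ⊕ᴾ x [ I⊕x-proper ])) (∉? I)
    (¬-resp (ProperIdeal.resp (I ⊕ᴾ x [ I⊕x-proper ]))) (¬-resp I.resp)
    (λ z z∉I⊕x z∈I → z∉I⊕x (⊆-⊕ I.isRightIdeal x z z∈I)) x∉I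
    (λ x∉I⊕x → x∉I⊕x (x∈⊕ I.isRightIdeal x))
    where module I = ProperIdeal I

  maximal-if-unextendable : (I : ProperIdeal) →
    ¬ (∃ λ x → ¬ member I x × Proper (member I ⊕ x)) → IsMaximalRightIdeal (member I)
  maximal-if-unextendable I unextendable = I.isRightIdeal , I.proper , absorbs
    where
    module I = ProperIdeal I
    absorbs : ∀ J → IsRightIdeal J → Proper J → member I ⊆ J → J ⊆ member I
    absorbs J J-ideal J-proper I⊆J z z∈J with I.member? z
    ... | yes z∈I = z∈I
    ... | no z∉I = ⊥-elim (unextendable
      (z , z∉I , λ 1∈I⊕z → J-proper (⊕-least I.isRightIdeal J-ideal I⊆J z∈J 1# 1∈I⊕z)))

  maximal-above : (I : ProperIdeal) →
    Σ ProperIdeal λ M → IsMaximalRightIdeal (member M) × member I ⊆ member M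
  maximal-above I = enlarge I (<-wellFounded (#outside I))
    where
    enlarge : (I : ProperIdeal) → Acc _<_ (#outside I) →
      Σ ProperIdeal λ M → IsMaximalRightIdeal (member M) × member I ⊆ member M
    enlarge I (acc smaller)
      with search (λ x → ¬ member I x × Proper (member I ⊕ x))
             (λ x≈x′ (x∉I , I⊕x-proper) →
               ¬-resp I.resp x≈x′ x∉I , ¬-resp (λ e → ⊕-cong e 1#) x≈x′ I⊕x-proper)
             (λ x → ∉? I x ×-dec ¬? (⊕-decidable I.isRightIdeal I.member? x 1#))
      where module I = ProperIdeal I
    ... | no unextendable = I , maximal-if-unextendable I unextendable , λ _ z∈I → z∈I
    ... | yes (x , x∉I , I⊕x-proper) =
      let (M , M-maximal , I⊕x⊆M) =
            enlarge (I ⊕ᴾ x [ I⊕x-proper ]) (smaller (#outside-⊕ I x∉I I⊕x-proper))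
      in M , M-maximal , λ z z∈I → I⊕x⊆M z (⊆-⊕ (ProperIdeal.isRightIdeal I) x z z∈I)

  -- Freeness makes the left annihilator of g trivial, so x ↦ xg is injective,
  -- hence surjective: αg = 1 for some α.  Then (gα - 1)g = 0 forces gα = 1.
  free-pair-in-principal⇒unit : ∀ {a b g} → FreeCyclic a b →
    principal g a → principal g b → principal g 1#
  free-pair-in-principal⇒unit {a} {b} {g} free a∈gR b∈gR = α , sym gα≈1
    where
    annihilator-trivial : ∀ x → x * g ≈ 0# → x ≈ 0#
    annihilator-trivial x xg≈0 = free x (kills a∈gR) (kills b∈gR)
      where
      kills : ∀ {z} → principal g z → x * z ≈ 0#
      kills {z} (y , z≈gy) = begin
        x * z          ≈⟨ *-congˡ z≈gy ⟩
        x * (g * y)    ≈⟨ *-assoc x g y ⟨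
        (x * g) * y    ≈⟨ *-congʳ xg≈0 ⟩
        0# * y         ≈⟨ zeroˡ y ⟩
        0#             ∎
    *g-injective : ∀ {x y} → x * g ≈ y * g → x ≈ y
    *g-injective {x} {y} xg≈yg = x∙y⁻¹≈ε⇒x≈y x y (annihilator-trivial (x - y) (begin
      (x - y) * g        ≈⟨ [y-z]x≈yx-zx g x y ⟩
      x * g - y * g      ≈⟨ +-congʳ xg≈yg ⟩
      y * g - y * g      ≈⟨ -‿inverseʳ (y * g) ⟩
      0#                 ∎))
    α : Carrier
    α = proj₁ (injective⇒surjective (_* g) *g-injective 1#)
    αg≈1 : α * g ≈ 1#
    αg≈1 = proj₂ (injective⇒surjective (_* g) *g-injective 1#)
    gα≈1 : g * α ≈ 1#
    gα≈1 = x∙y⁻¹≈ε⇒x≈y (g * α) 1# (annihilator-trivial (g * α - 1#) (begin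
      (g * α - 1#) * g       ≈⟨ [y-z]x≈yx-zx g (g * α) 1# ⟩
      g * α * g - 1# * g     ≈⟨ +-cong (*-assoc g α g) (-‿cong (*-identityˡ g)) ⟩
      g * (α * g) - g        ≈⟨ +-congʳ (trans (*-congˡ αg≈1) (*-identityʳ g)) ⟩
      g - g                  ≈⟨ -‿inverseʳ g ⟩
      0#                     ∎))

  -- If every element outside a proper right ideal M is right invertible,
  -- then multiplying by an element of M strictly shrinks nonzero principal
  -- ideals, and so M cannot contain a free pair.
  module OutsideUnits (M : ProperIdeal)
      (outside-units : ∀ u → ¬ member M u → principal u 1#) where
    private module M = ProperIdeal M

    -- α ∉ αmR: from α = αmy the element u = 1 - my lies outside M (as
    -- u + my = 1), hence is right invertible, while αu = 0; so α = 0.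
    principal-shrinks : ∀ {α m} → ¬ α ≈ 0# → member M m →
      # (principal? (α * m)) < # (principal? α)
    principal-shrinks {α} {m} α≉0 m∈M =
      #-< (principal? (α * m)) (principal? α) resp-αm resp-α
        (λ z (y , z≈αmy) → m * y , trans z≈αmy (*-assoc α m y))
        (1# , sym (*-identityʳ α)) α∉αmR
      where
      resp-αm : principal (α * m) Respects _≈_
      resp-αm = IsRightIdeal.resp (principal-isRightIdeal (α * m))
      resp-α : principal α Respects _≈_
      resp-α = IsRightIdeal.resp (principal-isRightIdeal α)
      α∉αmR : ¬ principal (α * m) α
      α∉αmR (y , α≈αmy) = α≉0 (begin
        α              ≈⟨ *-identityʳ α ⟨
        α * 1#         ≈⟨ *-congˡ 1≈uw ⟩
        α * (u * w)    ≈⟨ *-assoc α u w ⟨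
        (α * u) * w    ≈⟨ *-congʳ αu≈0 ⟩
        0# * w         ≈⟨ zeroˡ w ⟩
        0#             ∎)
        where
        u : Carrier
        u = 1# - m * y
        u∉M : ¬ member M u
        u∉M u∈M = M.proper (M.resp u+my≈1 (M.+-cl u∈M (M.*ʳ-cl y m∈M)))
          where
          u+my≈1 : u + m * y ≈ 1#
          u+my≈1 = trans (+-assoc 1# (- (m * y)) (m * y))
                     (trans (+-congˡ (-‿inverseˡ (m * y))) (+-identityʳ 1#))
        w : Carrier
        w = proj₁ (outside-units u u∉M)
        1≈uw : 1# ≈ u * w
        1≈uw = proj₂ (outside-units u u∉M)
        αu≈0 : α * u ≈ 0#
        αu≈0 = begin
          α * (1# - m * y)       ≈⟨ x[y-z]≈xy-xz α 1# (m * y) ⟩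
          α * 1# - α * (m * y)   ≈⟨ +-cong (*-identityʳ α) (-‿cong (sym (*-assoc α m y))) ⟩
          α - (α * m) * y        ≈⟨ +-congˡ (-‿cong α≈αmy) ⟨
          α - α                  ≈⟨ -‿inverseʳ α ⟩
          0#                     ∎

    -- By induction on |αR|: αa and αb vanish, so α vanishes by freeness.
    free-pair⇒trivial : ∀ {a b} → FreeCyclic a b → member M a → member M b → ∀ α → α ≈ 0#
    free-pair⇒trivial {a} {b} free a∈M b∈M α = vanishes α (<-wellFounded _)
      where
      vanishes : ∀ α → Acc _<_ (# (principal? α)) → α ≈ 0#
      vanishes α (acc smaller) with α ≈? 0#
      ... | yes α≈0 = α≈0
      ... | no α≉0 = free α
        (vanishes (α * a) (smaller (principal-shrinks α≉0 a∈M)))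
        (vanishes (α * b) (smaller (principal-shrinks α≉0 b∈M)))

  free-pair⇒non-unit-outside : ∀ (M : ProperIdeal) {a b} → FreeCyclic a b →
    member M a → member M b → ∃ λ u → ¬ member M u × ¬ principal u 1#
  free-pair⇒non-unit-outside M free a∈M b∈M
    with search (λ u → ¬ member M u × ¬ principal u 1#)
           (λ u≈u′ (u∉M , u-non-unit) →
             ¬-resp (ProperIdeal.resp M) u≈u′ u∉M ,
             ¬-resp (λ e (w , 1≈uw) → w , trans 1≈uw (*-congʳ e)) u≈u′ u-non-unit)
           (λ u → ∉? M u ×-dec ¬? (principal? u 1#))
  ... | yes found = found
  ... | no none = ⊥-elim (M.proper (M.resp (sym 1≈0) M.zero∈))
    where
    module M = ProperIdeal M
    outside-units : ∀ u → ¬ member M u → principal u 1#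
    outside-units u u∉M with principal? u 1#
    ... | yes unit = unit
    ... | no non-unit = ⊥-elim (none (u , u∉M , non-unit))
    1≈0 : 1# ≈ 0#
    1≈0 = OutsideUnits.free-pair⇒trivial M outside-units free a∈M b∈M 1#

  non-unimodular⇒proper-ideal : ∀ {a b} → ¬ Unimodular a b →
    Σ ProperIdeal λ I → member I a × member I b
  non-unimodular⇒proper-ideal {a} {b} non-unimodular =
    aR ⊕ᴾ b [ aR+bR-proper ] ,
    ⊆-⊕ aR-ideal b a (1# , sym (*-identityʳ a)) , x∈⊕ aR-ideal b
    where
    aR-ideal : IsRightIdeal (principal a)
    aR-ideal = principal-isRightIdeal a
    aR : ProperIdeal
    aR = principalᴾ a (λ (y , 1≈ay) → non-unimodular
      (y , 0# , trans (+-congˡ (zeroʳ b)) (trans (+-identityʳ (a * y)) (sym 1≈ay))))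
    aR+bR-proper : Proper (principal a ⊕ b)
    aR+bR-proper (i , y , (y′ , i≈ay′) , 1≈i+by) =
      non-unimodular (y′ , y , sym (trans 1≈i+by (+-congʳ i≈ay′)))

  free-pair⇒non-principal : (M : ProperIdeal) → ∀ {a b} → FreeCyclic a b →
    member M a → member M b → ¬ IsPrincipal (member M)
  free-pair⇒non-principal M free a∈M b∈M (g , M⊆gR , gR⊆M) = ProperIdeal.proper M
    (gR⊆M 1# (free-pair-in-principal⇒unit free (M⊆gR _ a∈M) (M⊆gR _ b∈M)))

  -- A proper right ideal M containing a free pair is avoided by some maximal
  -- right ideal: a non-unit u ∉ M generates a proper uR, and any maximal
  -- right ideal above uR contains u ∉ M.
  free-pair⇒other-maximal : (M : ProperIdeal) → ∀ {a b} → FreeCyclic a b →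
    member M a → member M b → Σ Subset λ J → IsMaximalRightIdeal J × ¬ (member M ≐ J)
  free-pair⇒other-maximal M free a∈M b∈M
    with u , u∉M , u-non-unit ← free-pair⇒non-unit-outside M free a∈M b∈M
    with J , J-maximal , uR⊆J ← maximal-above (principalᴾ u u-non-unit)
    = member J , J-maximal , λ (_ , J⊆M) → u∉M (J⊆M u (uR⊆J u (1# , sym (*-identityʳ u))))

mainTheorem1 : {c ℓ : Level} (R : Ring c ℓ) → RingNotions.Finite R →
    (a b : Ring.Carrier R) →
    ¬ RingNotions.Unimodular R a b → RingNotions.FreeCyclic R a b →
    (Σ (RingNotions.Subset R) λ I → Σ (RingNotions.Subset R) λ J →
        RingNotions.IsMaximalRightIdeal R I × RingNotions.IsMaximalRightIdeal R J
        × ¬ RingNotions._≐_ R I J)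
    × (Σ (RingNotions.Subset R) λ K →
        RingNotions.IsMaximalRightIdeal R K × ¬ RingNotions.IsPrincipal R K)
mainTheorem1 R finite a b non-unimodular free =
  let open FiniteRing R finite
      (I , a∈I , b∈I)       = non-unimodular⇒proper-ideal non-unimodular
      (M , M-maximal , I⊆M) = maximal-above I
      a∈M                   = I⊆M a a∈I
      b∈M                   = I⊆M b b∈I
      (J , J-maximal , M≢J) = free-pair⇒other-maximal M free a∈M b∈M
  in (member M , J , M-maximal , J-maximal , M≢J)
   , (member M , M-maximal , free-pair⇒non-principal M free a∈M b∈M)
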